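{- Let $f:2^{\mathcal{N}}\to\mathbb{Z}_{\ge0}$ be a polymatroid over a finite ground set $\mathcal{N}$ with $f(\{e\})>0$ for every $e\in\mathcal{N}$ and $f(\emptyset)=0$, and let $r=f(\mathcal{N})$. Let $e_1,\dots,e_n$ be an ordering of $\mathcal{N}$, $\mathcal{N}_t=\{e_1,\dots,e_t\}$, and for every $t\in[n]$ define $$q_t:=\min\{|Q|:\ e_t\in Q\subseteq\mathcal{N}_t\text{ and }Q\text{ is a quotient of }f_{|\mathcal{N}_t}\}.$$ Then for every positive integer $j$, $|\{t\in[n]: q_t=j\}|\le r$.
   Context: A polymatroid is an integer-valued, monotone, submodular set function with value $0$ on the empty set. For $S\subseteq\mathcal{N}$, $f_{|S}:2^S\to\mathbb{Z}_{\ge0}$ is the restriction $f_{|S}(T)=f(T)$. For a polymatroid $h:2^{\mathcal{V}}\to\mathbb{Z}_{\ge0}$, a set $Q\subseteq\mathcal{V}$ is a quotient of $h$ if $h((\mathcal{V}\setminus Q)\cup\{e\})>h(\mathcal{V}\setminus Q)$ for every $e\in Q$. -}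

module Defs where

open import Data.Nat using (ℕ; _+_; _≤_; _<_; _≤ᵇ_)
open import Data.Fin using (Fin; toℕ)
open import Data.Fin.Subset using (Subset; ⊥; ⁅_⁆; _∈_; _⊆_; _∪_; _∩_; _─_; ∣_∣)
open import Data.Vec using (tabulate)
open import Data.Product using (_×_; Σ-syntax)
open import Relation.Binary.PropositionalEquality using (_≡_)

record IsPolymatroid {n : ℕ} (f : Subset n → ℕ) : Set where
  field
    empty0     : f ⊥ ≡ 0
    monotone   : ∀ {A B} → A ⊆ B → f A ≤ f B
    submodular : ∀ A B → f (A ∪ B) + f (A ∩ B) ≤ f A + f B

-- The restriction f_{|S} : 2^S → ℕ, T ↦ f T, for T ⊆ S.
-- Q ⊆ S is a quotient of h : 2^S → ℕ iff h((S ∖ Q) ∪ {e}) > h(S ∖ Q) for all e ∈ Q.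
IsQuotientOfRestriction : {n : ℕ} → (Subset n → ℕ) → Subset n → Subset n → Set
IsQuotientOfRestriction f S Q =
  Q ⊆ S × (∀ e → e ∈ Q → f (S ─ Q) < f ((S ─ Q) ∪ ⁅ e ⁆))

-- N_t = {e_1,…,e_t}; with 0-based index t : Fin n this is {i | i ≤ t}.
prefix : {n : ℕ} → Fin n → Subset n
prefix t = tabulate (λ i → toℕ i ≤ᵇ toℕ t)

Admissible : {n : ℕ} → (Subset n → ℕ) → Fin n → Subset n → Set
Admissible f t Q = t ∈ Q × IsQuotientOfRestriction f (prefix t) Q

QEq : {n : ℕ} → (Subset n → ℕ) → Fin n → ℕ → Set
QEq f t j = Σ[ Q ∈ Subset _ ] (Admissible f t Q × ∣ Q ∣ ≡ j)
          × (∀ Q → Admissible f t Q → j ≤ ∣ Q ∣)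

-- Fix j and let T be a set of elements with q_t = j. If s < t both lie in T and
-- s belongs to a minimum quotient Q for t, then Q ∩ N_s is admissible for s and misses t,
-- so q_s < |Q| = j, which is absurd. Hence the elements of T before t avoid Q, i.e. lie in
-- N_t ∖ Q, and since t gains rank over N_t ∖ Q it gains rank over them too (diminishing
-- returns). Adding the elements of any S ⊆ T in increasing order therefore raises f by at
-- least one each time, so |S| ≤ f(S) ≤ f(N).
module Submission where

open import Defs
open import Data.Nat using (ℕ; zero; suc; _+_; _≤_; _<_; _≤ᵇ_; _<?_; z≤n; s≤s)
open import Data.Nat.Properties
open import Data.Bool.Properties using (T-≡)
open import Data.Fin using (Fin; toℕ; fromℕ<)
open import Data.Fin.Properties using (toℕ-injective; toℕ<n; toℕ-fromℕ<)
open import Data.Fin.Subset using (Subset; ⊤; ⊥; ⁅_⁆; inside; outside; _∈_; _∉_; _⊆_; _∪_; _∩_; _─_; _-_; ∣_∣)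
open import Data.Fin.Subset.Properties
open import Data.Vec using (_∷_; there; tail)
open import Data.Vec.Properties using ([]=⇒lookup; lookup⇒[]=; lookup∘tabulate)
open import Data.Product using (_,_; proj₂)
open import Data.Sum using (inj₁; inj₂; [_,_]′)
open import Function.Bundles using (Equivalence)
open import Relation.Nullary using (yes; no)
open import Relation.Binary.PropositionalEquality using (_≢_; sym; trans; subst)

private
  variable
    n : ℕ

x∈p─q⇒x∉q : ∀ (p q : Subset n) {x} → x ∈ p ─ q → x ∉ q
x∈p─q⇒x∉q (_ ∷ p) (inside  ∷ q) {Fin.zero} ()
x∈p─q⇒x∉q (_ ∷ p) (outside ∷ q) {Fin.zero} _ ()
x∈p─q⇒x∉q (_ ∷ p) (_ ∷ q) {Fin.suc x} x∈p─q x∈q = x∈p─q⇒x∉q p q (drop-there x∈p─q) (drop-there x∈q)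

-- The tail of p - 0 is not syntactically of the form q ─ ⊥, so p─⊥≡p cannot be used.
p⊆tail[p-0] : ∀ b (p : Subset n) → p ⊆ tail ((b ∷ p) - Fin.zero)
p⊆tail[p-0] b p y∈p = drop-there (x∈p∧x≢y⇒x∈p-y {p = b ∷ p} {y = Fin.zero} (there y∈p) λ ())

∣p∣≤1+∣p-x∣ : ∀ (p : Subset n) x → ∣ p ∣ ≤ suc ∣ p - x ∣
∣p∣≤1+∣p-x∣ (inside  ∷ p) Fin.zero    = s≤s (p⊆q⇒∣p∣≤∣q∣ (p⊆tail[p-0] inside p))
∣p∣≤1+∣p-x∣ (outside ∷ p) Fin.zero    = m≤n⇒m≤1+n (p⊆q⇒∣p∣≤∣q∣ (p⊆tail[p-0] outside p))
∣p∣≤1+∣p-x∣ (inside  ∷ p) (Fin.suc x) = s≤s (∣p∣≤1+∣p-x∣ p x)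
∣p∣≤1+∣p-x∣ (outside ∷ p) (Fin.suc x) = ∣p∣≤1+∣p-x∣ p x

p-x∪⁅x⁆⊆p : ∀ {p : Subset n} {x} → x ∈ p → (p - x) ∪ ⁅ x ⁆ ⊆ p
p-x∪⁅x⁆⊆p {p = p} {x} x∈p y∈ with x∈p∪q⁻ (p - x) ⁅ x ⁆ y∈
... | inj₁ y∈p-x = p─q⊆p p ⁅ x ⁆ y∈p-x
... | inj₂ y∈⁅x⁆ = subst (_∈ p) (sym (x∈⁅y⁆⇒x≡y x y∈⁅x⁆)) x∈p

∈prefix⁻ : ∀ {i t : Fin n} → i ∈ prefix t → toℕ i ≤ toℕ t
∈prefix⁻ {i = i} {t} i∈ = ≤ᵇ⇒≤ (toℕ i) (toℕ t) (Equivalence.from T-≡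
  (trans (sym (lookup∘tabulate (λ k → toℕ k ≤ᵇ toℕ t) i)) ([]=⇒lookup i∈)))

∈prefix⁺ : ∀ {i t : Fin n} → toℕ i ≤ toℕ t → i ∈ prefix t
∈prefix⁺ {i = i} {t} i≤t = lookup⇒[]= i _
  (trans (lookup∘tabulate (λ k → toℕ k ≤ᵇ toℕ t) i) (Equivalence.to T-≡ (≤⇒≤ᵇ i≤t)))

<1+k∧≢fromℕ<⇒<k : ∀ {k} {i : Fin n} (k<n : k < n) → toℕ i < suc k → i ≢ fromℕ< k<n
                 → toℕ i < k
<1+k∧≢fromℕ<⇒<k k<n i≤k i≢k = ≤∧≢⇒< (≤-pred i≤k) λ i≡k →
  i≢k (toℕ-injective (trans i≡k (sym (toℕ-fromℕ< k<n))))

module _ {f : Subset n → ℕ} (pm : IsPolymatroid f) where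
  open IsPolymatroid pm

  marginal-antitone : ∀ {B C} e → B ⊆ C → f C < f (C ∪ ⁅ e ⁆) → f B < f (B ∪ ⁅ e ⁆)
  marginal-antitone {B} {C} e B⊆C gainC = +-cancelˡ-< (f C) (f B) (f (B ∪ ⁅ e ⁆)) (begin-strict
    f C + f B                                 <⟨ +-monoˡ-< (f B) gainC ⟩
    f (C ∪ ⁅ e ⁆) + f B                       ≤⟨ +-mono-≤ (monotone C∪e⊆) (monotone B⊆∩) ⟩
    f ((B ∪ ⁅ e ⁆) ∪ C) + f ((B ∪ ⁅ e ⁆) ∩ C) ≤⟨ submodular (B ∪ ⁅ e ⁆) C ⟩
    f (B ∪ ⁅ e ⁆) + f C                       ≡⟨ +-comm (f (B ∪ ⁅ e ⁆)) (f C) ⟩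
    f C + f (B ∪ ⁅ e ⁆)                       ∎)
    where
      open ≤-Reasoning
      C∪e⊆ : C ∪ ⁅ e ⁆ ⊆ (B ∪ ⁅ e ⁆) ∪ C
      C∪e⊆ x∈ = [ q⊆p∪q _ C , (λ x∈e → p⊆p∪q C (q⊆p∪q B _ x∈e)) ]′ (x∈p∪q⁻ C ⁅ e ⁆ x∈)
      B⊆∩ : B ⊆ (B ∪ ⁅ e ⁆) ∩ C
      B⊆∩ x∈B = x∈p∩q⁺ (p⊆p∪q ⁅ e ⁆ x∈B , B⊆C x∈B)

  admissible-restrict : ∀ {s t Q} → Admissible f t Q → s ∈ Q → toℕ s ≤ toℕ t
                      → Admissible f s (Q ∩ prefix s)
  admissible-restrict {s} {t} {Q} (_ , _ , quotient) s∈Q s≤t =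
    x∈p∩q⁺ (s∈Q , ∈prefix⁺ ≤-refl) , p∩q⊆q Q (prefix s) ,
    λ e e∈ → marginal-antitone e outside⊆ (quotient e (p∩q⊆p Q (prefix s) e∈))
    where
      outside⊆ : prefix s ─ (Q ∩ prefix s) ⊆ prefix t ─ Q
      outside⊆ {x} x∈ = x∈p∧x∉q⇒x∈p─q (∈prefix⁺ (≤-trans (∈prefix⁻ x∈N) s≤t))
        λ x∈Q → x∈p─q⇒x∉q (prefix s) (Q ∩ prefix s) x∈ (x∈p∩q⁺ (x∈Q , x∈N))
        where
          x∈N : x ∈ prefix s
          x∈N = p─q⊆p (prefix s) (Q ∩ prefix s) x∈

  earlier-member-of-quotient : ∀ {j s t Q} → Admissible f t Q → s ∈ Q → toℕ s < toℕ t
                             → (∀ Q′ → Admissible f s Q′ → j ≤ ∣ Q′ ∣) → j < ∣ Q ∣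
  earlier-member-of-quotient {s = s} {t} {Q} adm@(t∈Q , _) s∈Q s<t minimal =
    ≤-<-trans (minimal _ (admissible-restrict adm s∈Q (<⇒≤ s<t)))
              (p⊂q⇒∣p∣<∣q∣ (p∩q⊆p Q (prefix s) , t , t∈Q , t∉))
    where
      t∉ : t ∉ Q ∩ prefix s
      t∉ t∈ = <⇒≱ s<t (∈prefix⁻ (proj₂ (x∈p∩q⁻ Q (prefix s) t∈)))

  module _ {j} {T : Subset n} (level : ∀ t → t ∈ T → QEq f t j) where

    gain-over-earlier : ∀ {S t} → t ∈ T → S ⊆ T → (∀ i → i ∈ S → toℕ i < toℕ t)
                      → f S < f (S ∪ ⁅ t ⁆)
    gain-over-earlier {S} {t} t∈T S⊆T S<t with level t t∈T
    ... | Q , (adm@(t∈Q , _ , quotient) , ∣Q∣≡j) , _ =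
      marginal-antitone t S⊆outside (quotient t t∈Q)
      where
        S⊆outside : S ⊆ prefix t ─ Q
        S⊆outside {i} i∈S = x∈p∧x∉q⇒x∈p─q (∈prefix⁺ (<⇒≤ (S<t i i∈S))) λ i∈Q →
          <-irrefl (sym ∣Q∣≡j)
            (earlier-member-of-quotient adm i∈Q (S<t i i∈S) (proj₂ (proj₂ (level i (S⊆T i∈S)))))

    card≤f-below : ∀ k S → S ⊆ T → (∀ i → i ∈ S → toℕ i < k) → ∣ S ∣ ≤ f S
    card≤f-below zero S _ S<0 rewrite Empty-unique (λ (i , i∈S) → n≮0 (S<0 i i∈S)) =
      subst (_≤ f ⊥) (sym (∣⊥∣≡0 n)) z≤n
    card≤f-below (suc k) S S⊆T S<k+1 with k <? n
    ... | no k≮n = card≤f-below k S S⊆T λ i _ → <-≤-trans (toℕ<n i) (≮⇒≥ k≮n)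
    ... | yes k<n with fromℕ< k<n ∈? S
    ...   | no t∉S = card≤f-below k S S⊆T λ i i∈S →
            <1+k∧≢fromℕ<⇒<k k<n (S<k+1 i i∈S) λ i≡t → t∉S (subst (_∈ S) i≡t i∈S)
    ...   | yes t∈S = begin
            ∣ S ∣               ≤⟨ ∣p∣≤1+∣p-x∣ S t ⟩
            suc ∣ S - t ∣       ≤⟨ s≤s (card≤f-below k (S - t) S-t⊆T S-t<k) ⟩
            suc (f (S - t))     ≤⟨ gain-over-earlier (S⊆T t∈S) S-t⊆T S-t<t ⟩
            f ((S - t) ∪ ⁅ t ⁆) ≤⟨ IsPolymatroid.monotone pm (p-x∪⁅x⁆⊆p t∈S) ⟩
            f S                 ∎
      where
        open ≤-Reasoning
        t = fromℕ< k<n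
        S-t⊆T : S - t ⊆ T
        S-t⊆T i∈ = S⊆T (p─q⊆p S ⁅ t ⁆ i∈)
        S-t<k : ∀ i → i ∈ S - t → toℕ i < k
        S-t<k i i∈ = <1+k∧≢fromℕ<⇒<k k<n (S<k+1 i (p─q⊆p S ⁅ t ⁆ i∈))
                       (x∉⁅y⁆⇒x≢y (x∈p─q⇒x∉q S ⁅ t ⁆ i∈))
        S-t<t : ∀ i → i ∈ S - t → toℕ i < toℕ t
        S-t<t i i∈ = subst (toℕ i <_) (sym (toℕ-fromℕ< k<n)) (S-t<k i i∈)

lemma3p1 : (n : ℕ) (f : Subset n → ℕ) → IsPolymatroid f
    → (∀ (e : Fin n) → 0 < f ⁅ e ⁆)
    → (j : ℕ) → 1 ≤ j
    → (T : Subset n) → (∀ t → t ∈ T → QEq f t j)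
    → ∣ T ∣ ≤ f ⊤
lemma3p1 n f pm _ j _ T level =
  ≤-trans (card≤f-below pm level n T (λ t∈T → t∈T) (λ i _ → toℕ<n i))
          (IsPolymatroid.monotone pm ⊆⊤)
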